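{- Let $\mathcal{V}$ be a subspace arrangement, let $\mathcal{T}^b=(T^b,\lambda^b)$ and $\mathcal{T}=(T,\lambda)$ be rooted rank decompositions of $\mathcal{V}$, and let $x,y\in V(T^b)$. Suppose $\mathcal{T}_{\mathrm{swap}}$ is obtained from $\mathcal{T}$ by performing an $x$-swap along a vertical path $v_0v_1v_2v_3$. Then the $y$-mixed skeletons of $\mathcal{T}$ and $\mathcal{T}_{\mathrm{swap}}$ are equal.
   Context: Let $\mathbb{F}=\mathrm{GF}(2)$; a subspace arrangement is a family $\mathcal{V}$ of linear subspaces of $\mathbb{F}^d$. A rooted rank decomposition $(T,\lambda)$ of $\mathcal{V}$: $T$ a rooted binary tree (nodes have $0$ or $2$ children, root not a leaf), $\lambda$ a bijection from $\mathcal{V}$ to the leaves; $\mathcal{L}(\mathcal{T})[t]$ is the subfamily mapped to leaves descending from $t$. For $x\in V(T^b)$ let $\mathcal{V}_x=\mathcal{L}(\mathcal{T}^b)[x]$. A node $v$ of $T$ is $x$-full if $\mathcal{L}(\mathcal{T})[v]\subseteq\mathcal{V}_x$, $x$-empty if $\mathcal{L}(\mathcal{T})[v]\cap\mathcal{V}_x=\emptyset$, $x$-mixed otherwise. A node with two children is an $x$-leaf point if one child is $x$-empty and the other $x$-full, and an $x$-branch point if both children are $x$-mixed. The $x$-mixed skeleton of $\mathcal{T}$ is the rooted tree whose nodes are the $x$-leaf points and $x$-branch points of $T$, two being adjacent iff the path between them in $T$ is internally disjoint from this node set. A vertical path $v_0v_1v_2v_3$ means $v_{i+1}$ is a child of $v_i$.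 A swap of $\mathcal{T}$ along it replaces this path by the vertical path $v_0v_2v_1v_3$ (so $v_2$ becomes a child of $v_0$, $v_1$ a child of $v_2$, $v_3$ a child of $v_1$, with the other children $v_1'$ of $v_1$ and $v_2'$ of $v_2$, and the rest of the tree and $\lambda$, unchanged). It is an $x$-swap if $v_3$ is $x$-mixed and exactly one of $v_1',v_2'$ is $x$-empty while the other is $x$-full. Two skeletons are equal if they have the same node sets and edge sets. -}

module Defs where

open import Data.Nat using (ℕ)
open import Data.Bool using (Bool; false; _xor_)
open import Data.Fin using (Fin)
open import Data.Vec using (Vec; replicate; zipWith)
open import Data.List using (List; []; _∷_; _++_; _∷ʳ_; allFin)
open import Data.List.Membership.Propositional using (_∈_)
open import Data.List.Relation.Unary.All using (All)
open import Data.List.Relation.Unary.Unique.Propositional using (Unique)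
open import Data.List.Relation.Binary.Permutation.Propositional using (_↭_)
open import Data.Product using (Σ; ∃; _×_; _,_)
open import Data.Sum using (_⊎_)
open import Data.Empty using (⊥)
open import Data.Unit using (⊤)
open import Relation.Nullary using (¬_)
open import Relation.Binary.PropositionalEquality using (_≡_)

-- Linear subspaces of GF(2)^d (vectors = Vec Bool d, addition = xor).
-- (The subspaces themselves play no role in the lemma; a subspace
-- arrangement with n members is indexed by Fin n.)

record Subspace (d : ℕ) : Set₁ where
  field
    Carrier  : Vec Bool d → Set
    zero∈    : Carrier (replicate d false)
    closed+  : ∀ {u v} → Carrier u → Carrier v → Carrier (zipWith _xor_ u v)

Arrangement : ℕ → ℕ → Set₁
Arrangement d n = Fin n → Subspace d

-- Rooted binary trees with named nodes; leaves carry a member (index)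
-- of the arrangement.  Node names are natural numbers.

data BT (n : ℕ) : Set where
  lf : ℕ → Fin n → BT n
  nd : ℕ → BT n → BT n → BT n

module _ {n : ℕ} where

  name : BT n → ℕ
  name (lf a _)   = a
  name (nd a _ _) = a

  names : BT n → List ℕ
  names (lf a _)   = a ∷ []
  names (nd a l r) = a ∷ (names l ++ names r)

  leaves : BT n → List (Fin n)
  leaves (lf _ e)   = e ∷ []
  leaves (nd _ l r) = leaves l ++ leaves r

  IsInternal : BT n → Set
  IsInternal (lf _ _)   = ⊥
  IsInternal (nd _ _ _) = ⊤

  -- rooted rank decomposition of an n-member arrangement:
  -- root not a leaf, node names distinct, λ a bijection onto the leaves.
  IsRRD : BT n → Set
  IsRRD t = IsInternal t × Unique (names t) × (leaves t ↭ allFin n)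

  data _⊑_ : BT n → BT n → Set where
    ⊑-refl : ∀ {t} → t ⊑ t
    ⊑-l    : ∀ {s a l r} → s ⊑ l → s ⊑ nd a l r
    ⊑-r    : ∀ {s a l r} → s ⊑ r → s ⊑ nd a l r

  Full : (Fin n → Set) → BT n → Set
  Full S t = ∀ {e} → e ∈ leaves t → S e

  Empty : (Fin n → Set) → BT n → Set
  Empty S t = ∀ {e} → e ∈ leaves t → ¬ S e

  Mixed : (Fin n → Set) → BT n → Set
  Mixed S t = ¬ Full S t × ¬ Empty S t

  LeafPoint : (Fin n → Set) → BT n → Set
  LeafPoint S (lf _ _)   = ⊥
  LeafPoint S (nd _ l r) = (Empty S l × Full S r) ⊎ (Full S l × Empty S r)

  BranchPoint : (Fin n → Set) → BT n → Set
  BranchPoint S (lf _ _)   = ⊥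
  BranchPoint S (nd _ l r) = Mixed S l × Mixed S r

  SkelNode : (Fin n → Set) → BT n → ℕ → Set
  SkelNode S t a =
    Σ (BT n) λ s → s ⊑ t × name s ≡ a × (LeafPoint S s ⊎ BranchPoint S s)

  ParentChild : BT n → ℕ → ℕ → Set
  ParentChild t a b =
    Σ (BT n) λ l → Σ (BT n) λ r → nd a l r ⊑ t × (name l ≡ b ⊎ name r ≡ b)

  TEdge : BT n → ℕ → ℕ → Set
  TEdge t a b = ParentChild t a b ⊎ ParentChild t b a

  data Walk (t : BT n) : ℕ → ℕ → List ℕ → Set where
    edge : ∀ {a b} → TEdge t a b → Walk t a b []
    step : ∀ {a b c is} → TEdge t a c → Walk t c b is → Walk t a b (c ∷ is)

  -- a and b are adjacent in the skeleton: both skeleton nodes and the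
  -- (unique) path between them in t is internally disjoint from the skeleton
  SkelEdge : (Fin n → Set) → BT n → ℕ → ℕ → Set
  SkelEdge S t a b =
    SkelNode S t a × SkelNode S t b ×
    Σ (List ℕ) λ is → Walk t a b is × Unique (a ∷ is ∷ʳ b)
                      × All (λ c → ¬ SkelNode S t c) is

  SameSkeleton : (Fin n → Set) → BT n → BT n → Set
  SameSkeleton S t t' =
    (∀ a → (SkelNode S t a → SkelNode S t' a) × (SkelNode S t' a → SkelNode S t a)) ×
    (∀ a b → (SkelEdge S t a b → SkelEdge S t' a b) × (SkelEdge S t' a b → SkelEdge S t a b))

  -- Swap1 s s' v₁' v₂' v₃ : s is the subtree at v₁, whose child
  -- v₂ has children v₃ and v₂'; v₁'s other child is v₁'.  s' is the
  -- subtree now rooted at v₂ (which takes v₁'s place under v₀), with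
  -- children v₂' and v₁, where v₁ has children v₁' and v₃.
  data Swap1 : BT n → BT n → BT n → BT n → BT n → Set where
    LL : ∀ a b v1' v2' v3 →
         Swap1 (nd a (nd b v3 v2') v1') (nd b (nd a v3 v1') v2') v1' v2' v3
    LR : ∀ a b v1' v2' v3 →
         Swap1 (nd a (nd b v2' v3) v1') (nd b v2' (nd a v3 v1')) v1' v2' v3
    RL : ∀ a b v1' v2' v3 →
         Swap1 (nd a v1' (nd b v3 v2')) (nd b (nd a v1' v3) v2') v1' v2' v3
    RR : ∀ a b v1' v2' v3 →
         Swap1 (nd a v1' (nd b v2' v3)) (nd b v2' (nd a v1' v3)) v1' v2' v3

  -- swap of t along a vertical path v₀v₁v₂v₃ (v₀ = parent of v₁)
  data Swap : BT n → BT n → BT n → BT n → BT n → Set where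
    hereL  : ∀ {c l l' r v1' v2' v3} → Swap1 l l' v1' v2' v3 →
             Swap (nd c l r) (nd c l' r) v1' v2' v3
    hereR  : ∀ {c l r r' v1' v2' v3} → Swap1 r r' v1' v2' v3 →
             Swap (nd c l r) (nd c l r') v1' v2' v3
    thereL : ∀ {c l l' r v1' v2' v3} → Swap l l' v1' v2' v3 →
             Swap (nd c l r) (nd c l' r) v1' v2' v3
    thereR : ∀ {c l r r' v1' v2' v3} → Swap r r' v1' v2' v3 →
             Swap (nd c l r) (nd c l r') v1' v2' v3

  XSwap : (Fin n → Set) → BT n → BT n → Set
  XSwap S t t' =
    Σ (BT n) λ v1' → Σ (BT n) λ v2' → Σ (BT n) λ v3 →
      Swap t t' v1' v2' v3 × Mixed S v3 ×
      ((Empty S v1' × Full S v2') ⊎ (Full S v1' × Empty S v2'))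

  Fam : BT n → Fin n → Set
  Fam x e = e ∈ leaves x

module Submission where

-- Only v₁ and v₂ get new children, and every other node keeps its set of leaves, so at most
-- v₁ and v₂ can change their status in the y-skeleton, and the only tree edges that change are
-- v₀v₁ and v₂v₃, which become v₀v₂ and v₁v₃.  Because V_x and V_y are nested or disjoint, the
-- x-swap condition forces one of v₁', v₂' to be y-pure of a kind that v₃ absorbs: adding its
-- leaves to those of v₃ does not change the y-kind of v₃.  A computation with the three kinds
-- (full, empty, mixed) then shows that v₁ and v₂ keep their status.
-- Say v₃ absorbs v₂'.  Then v₂ is outside the skeleton in both trees.  A path between skeleton
-- nodes cannot enter the pure subtree at v₂', so if it passes through v₂ it also passes through
-- v₁.  Hence the edges v₀v₁ and v₂v₃ of such a path can be replaced by v₀v₂v₁ and v₂v₁v₃ in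
-- T_swap without using new skeleton nodes, and shortcutting the resulting walk gives a path.
-- If v₃ absorbs v₁' instead, v₁ plays the part of v₂.  The converse inclusions come from the
-- reversed swap.

open import Defs
open import Algebra.Bundles using (CommutativeSemigroup; CommutativeMonoid)
import Algebra.Properties.CommutativeSemigroup as CommutativeSemigroupProperties
open import Data.Bool using (Bool; true; false)
open import Data.Empty using (⊥; ⊥-elim)
open import Data.Fin using (Fin)
import Data.Fin as Fin
open import Data.List using (List; []; _∷_; _++_; _∷ʳ_)
open import Data.List.Membership.Propositional using (_∈_; _∉_)
open import Data.List.Membership.Propositional.Properties using (∈-++⁺ˡ; ∈-++⁺ʳ; ∈-++⁻)
import Data.List.Membership.DecPropositional as DecMembership
open import Data.List.Relation.Binary.Permutation.Propositional
  using (_↭_; ↭-refl; ↭-sym; prep; swap; ↭⇒↭ₛ; module PermutationReasoning)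
open import Data.List.Relation.Binary.Permutation.Propositional.Properties
  using (++-comm; ++⁺ˡ; ++⁺ʳ; ++-commutativeMonoid)
open import Data.List.Relation.Binary.Subset.Propositional using (_⊆_)
open import Data.List.Relation.Unary.Any using (here; there)
open import Data.List.Relation.Unary.All as All using (All; []; _∷_)
import Data.List.Relation.Unary.All.Properties as All
open import Data.List.Relation.Unary.AllPairs using ([]; _∷_)
open import Data.List.Relation.Unary.Unique.Propositional using (Unique)
open import Data.List.Relation.Unary.Unique.Propositional.Properties using (Unique[x∷xs]⇒x∉xs; allFin⁺)
open import Data.Nat using (ℕ; _≟_)
open import Data.Product using (Σ; ∃-syntax; _×_; _,_; proj₁; proj₂)
import Data.Product as Product
open import Data.Sum using (_⊎_; inj₁; inj₂)
import Data.Sum as Sum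
open import Function using (_∘_)
open import Relation.Binary.Construct.Closure.ReflexiveTransitive using (Star; ε; _◅_; _◅◅_)
import Relation.Binary.Construct.Closure.ReflexiveTransitive as Star
open import Relation.Binary.PropositionalEquality
  using (_≡_; _≢_; refl; sym; trans; cong; subst; setoid; module ≡-Reasoning)
open import Relation.Binary.PropositionalEquality.Algebra using (isMagma)
open import Relation.Nullary using (¬_; Dec; yes; no)
import Data.List.Relation.Binary.Permutation.Setoid.Properties as PermutationProperties

open DecMembership _≟_ using (_∈?_)

module _ {A : Set} where

  unique-↭ : {xs ys : List A} → xs ↭ ys → Unique xs → Unique ys
  unique-↭ xs↭ys = PermutationProperties.Unique-resp-↭ (setoid A) (↭⇒↭ₛ xs↭ys)

  unique-++ˡ : ∀ xs {ys : List A} → Unique (xs ++ ys) → Unique xs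
  unique-++ˡ []       _        = []
  unique-++ˡ (x ∷ xs) (x∉ ∷ u) = All.++⁻ˡ xs x∉ ∷ unique-++ˡ xs u

  unique-++ʳ : ∀ xs {ys : List A} → Unique (xs ++ ys) → Unique ys
  unique-++ʳ []       u       = u
  unique-++ʳ (x ∷ xs) (_ ∷ u) = unique-++ʳ xs u

  unique-++-disjoint : ∀ xs {ys : List A} {z} → Unique (xs ++ ys) → z ∈ xs → z ∉ ys
  unique-++-disjoint (x ∷ xs) (x∉ ∷ _) (here refl) z∈ys = All.lookup x∉ (∈-++⁺ʳ xs z∈ys) refl
  unique-++-disjoint (x ∷ xs) (_ ∷ u)  (there z∈)  z∈ys = unique-++-disjoint xs u z∈ z∈ys

  endpoints-distinct : {x z : A} {is : List A} → Unique (x ∷ is ∷ʳ z) → x ≢ z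
  endpoints-distinct {is = is} (x∉ ∷ _) = All.lookup x∉ (∈-++⁺ʳ is (here refl))

  module _ {x z w : A} {is : List A} where

    interior-distinct : Unique (x ∷ is ∷ʳ z) → w ∈ is → w ≢ x × w ≢ z
    interior-distinct (x∉ ∷ u) w∈ =
      (λ w≡x → All.lookup x∉ (∈-++⁺ˡ w∈) (sym w≡x)) ,
      (λ w≡z → unique-++-disjoint is u w∈ (here w≡z))

    ∈-interior : w ∈ x ∷ is ∷ʳ z → w ≢ x → w ≢ z → w ∈ is
    ∈-interior (here w≡x) w≢x _ = ⊥-elim (w≢x w≡x)
    ∈-interior (there w∈) _ w≢z with ∈-++⁻ is w∈
    ... | inj₁ w∈is        = w∈is
    ... | inj₂ (here w≡z) = ⊥-elim (w≢z w≡z)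

-- Trees with distinct node names

module _ {n : ℕ} where

  ⊑-trans : {s t u : BT n} → s ⊑ t → t ⊑ u → s ⊑ u
  ⊑-trans p ⊑-refl  = p
  ⊑-trans p (⊑-l q) = ⊑-l (⊑-trans p q)
  ⊑-trans p (⊑-r q) = ⊑-r (⊑-trans p q)

  Child : BT n → BT n → Set
  Child c (lf _ _)   = ⊥
  Child c (nd _ l r) = c ≡ l ⊎ c ≡ r

  child-⊑ : {c N : BT n} → Child c N → c ⊑ N
  child-⊑ {N = nd _ _ _} (inj₁ refl) = ⊑-l ⊑-refl
  child-⊑ {N = nd _ _ _} (inj₂ refl) = ⊑-r ⊑-refl

  ⊑-parent : {s t : BT n} → s ⊑ t → s ≡ t ⊎ ∃[ N ] N ⊑ t × Child s N
  ⊑-parent ⊑-refl = inj₁ refl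
  ⊑-parent (⊑-l {a = a} {l} {r} p) with ⊑-parent p
  ... | inj₁ refl             = inj₂ (nd a l r , ⊑-refl , inj₁ refl)
  ... | inj₂ (N , N⊑l , s◃N) = inj₂ (N , ⊑-l N⊑l , s◃N)
  ⊑-parent (⊑-r {a = a} {l} {r} p) with ⊑-parent p
  ... | inj₁ refl             = inj₂ (nd a l r , ⊑-refl , inj₂ refl)
  ... | inj₂ (N , N⊑r , s◃N) = inj₂ (N , ⊑-r N⊑r , s◃N)

  name∈names : (t : BT n) → name t ∈ names t
  name∈names (lf _ _)   = here refl
  name∈names (nd _ _ _) = here refl

  names-⊑ : {s t : BT n} {z : ℕ} → s ⊑ t → z ∈ names s → z ∈ names t
  names-⊑ ⊑-refl            z∈ = z∈
  names-⊑ (⊑-l p)           z∈ = there (∈-++⁺ˡ (names-⊑ p z∈))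
  names-⊑ (⊑-r {l = l} p)   z∈ = there (∈-++⁺ʳ (names l) (names-⊑ p z∈))

  name-⊑ : {s t : BT n} → s ⊑ t → name s ∈ names t
  name-⊑ {s} p = names-⊑ p (name∈names s)

  ∈names⇒⊑ : (t : BT n) {z : ℕ} → z ∈ names t → ∃[ s ] s ⊑ t × name s ≡ z
  ∈names⇒⊑ (lf a e)   (here refl) = lf a e , ⊑-refl , refl
  ∈names⇒⊑ (nd a l r) (here refl) = nd a l r , ⊑-refl , refl
  ∈names⇒⊑ (nd a l r) (there z∈) with ∈-++⁻ (names l) z∈
  ... | inj₁ z∈l = let s , s⊑ , eq = ∈names⇒⊑ l z∈l in s , ⊑-l s⊑ , eq
  ... | inj₂ z∈r = let s , s⊑ , eq = ∈names⇒⊑ r z∈r in s , ⊑-r s⊑ , eq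

  leaves-⊑ : {s t : BT n} {e : Fin n} → s ⊑ t → e ∈ leaves s → e ∈ leaves t
  leaves-⊑ ⊑-refl          e∈ = e∈
  leaves-⊑ (⊑-l p)         e∈ = ∈-++⁺ˡ (leaves-⊑ p e∈)
  leaves-⊑ (⊑-r {l = l} p) e∈ = ∈-++⁺ʳ (leaves l) (leaves-⊑ p e∈)

  UniquelyNamed : BT n → Set
  UniquelyNamed t = Unique (names t)

  module _ {a : ℕ} {l r : BT n} where

    uniquelyNamed-l : UniquelyNamed (nd a l r) → UniquelyNamed l
    uniquelyNamed-l (_ ∷ u) = unique-++ˡ (names l) u

    uniquelyNamed-r : UniquelyNamed (nd a l r) → UniquelyNamed r
    uniquelyNamed-r (_ ∷ u) = unique-++ʳ (names l) u

    root∉names-l : UniquelyNamed (nd a l r) → a ∉ names l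
    root∉names-l u a∈ = Unique[x∷xs]⇒x∉xs u (∈-++⁺ˡ a∈)

    root∉names-r : UniquelyNamed (nd a l r) → a ∉ names r
    root∉names-r u a∈ = Unique[x∷xs]⇒x∉xs u (∈-++⁺ʳ (names l) a∈)

    names-l∩r : UniquelyNamed (nd a l r) → ∀ {z} → z ∈ names l → z ∉ names r
    names-l∩r (_ ∷ u) = unique-++-disjoint (names l) u

  uniquelyNamed-⊑ : {s t : BT n} → s ⊑ t → UniquelyNamed t → UniquelyNamed s
  uniquelyNamed-⊑ ⊑-refl  u = u
  uniquelyNamed-⊑ (⊑-l p) u = uniquelyNamed-⊑ p (uniquelyNamed-l u)
  uniquelyNamed-⊑ (⊑-r p) u = uniquelyNamed-⊑ p (uniquelyNamed-r u)

  name-injective : {s s' t : BT n} → UniquelyNamed t → s ⊑ t → s' ⊑ t → name s ≡ name s' → s ≡ s'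
  name-injective u ⊑-refl  ⊑-refl   _  = refl
  name-injective u ⊑-refl  (⊑-l p') eq = ⊥-elim (root∉names-l u (subst (_∈ _) (sym eq) (name-⊑ p')))
  name-injective u ⊑-refl  (⊑-r p') eq = ⊥-elim (root∉names-r u (subst (_∈ _) (sym eq) (name-⊑ p')))
  name-injective u (⊑-l p) ⊑-refl   eq = ⊥-elim (root∉names-l u (subst (_∈ _) eq (name-⊑ p)))
  name-injective u (⊑-r p) ⊑-refl   eq = ⊥-elim (root∉names-r u (subst (_∈ _) eq (name-⊑ p)))
  name-injective u (⊑-l p) (⊑-l p') eq = name-injective (uniquelyNamed-l u) p p' eq
  name-injective u (⊑-r p) (⊑-r p') eq = name-injective (uniquelyNamed-r u) p p' eq
  name-injective u (⊑-l p) (⊑-r p') eq =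
    ⊥-elim (names-l∩r u (name-⊑ p) (subst (_∈ _) (sym eq) (name-⊑ p')))
  name-injective u (⊑-r p) (⊑-l p') eq =
    ⊥-elim (names-l∩r u (name-⊑ p') (subst (_∈ _) eq (name-⊑ p)))

  ∈names-⊑ : {s K t : BT n} → UniquelyNamed t → K ⊑ t → s ⊑ t → name s ∈ names K → s ⊑ K
  ∈names-⊑ {K = K} u K⊑t s⊑t s∈K with ∈names⇒⊑ K s∈K
  ... | s' , s'⊑K , eq with name-injective u s⊑t (⊑-trans s'⊑K K⊑t) (sym eq)
  ... | refl = s'⊑K

  root∉child : {c N : BT n} → UniquelyNamed N → Child c N → name N ∉ names c
  root∉child {N = nd _ _ _} u (inj₁ refl) = root∉names-l u
  root∉child {N = nd _ _ _} u (inj₂ refl) = root∉names-r u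

  in-both-subtrees : {a : ℕ} {s l r : BT n} → UniquelyNamed (nd a l r) → s ⊑ l → s ⊑ r → ⊥
  in-both-subtrees u s⊑l s⊑r = names-l∩r u (name-⊑ s⊑l) (name-⊑ s⊑r)

  no-shared-child-l : {a : ℕ} {N c l r : BT n} → UniquelyNamed (nd a l r) →
                    N ⊑ l → Child c (nd a l r) → Child c N → ⊥
  no-shared-child-l u N⊑l (inj₁ refl) c◃N =
    root∉child (uniquelyNamed-⊑ N⊑l (uniquelyNamed-l u)) c◃N (name-⊑ N⊑l)
  no-shared-child-l u N⊑l (inj₂ refl) c◃N = in-both-subtrees u (⊑-trans (child-⊑ c◃N) N⊑l) ⊑-refl

  no-shared-child-r : {a : ℕ} {N c l r : BT n} → UniquelyNamed (nd a l r) →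
                     N ⊑ r → Child c (nd a l r) → Child c N → ⊥
  no-shared-child-r u N⊑r (inj₂ refl) c◃N =
    root∉child (uniquelyNamed-⊑ N⊑r (uniquelyNamed-r u)) c◃N (name-⊑ N⊑r)
  no-shared-child-r u N⊑r (inj₁ refl) c◃N = in-both-subtrees u ⊑-refl (⊑-trans (child-⊑ c◃N) N⊑r)

  parent-unique : {t N N' c : BT n} → UniquelyNamed t →
                  N ⊑ t → N' ⊑ t → Child c N → Child c N' → N ≡ N'
  parent-unique u ⊑-refl  ⊑-refl   _ _ = refl
  parent-unique u ⊑-refl  (⊑-l p') k k' = ⊥-elim (no-shared-child-l u p' k k')
  parent-unique u ⊑-refl  (⊑-r p') k k' = ⊥-elim (no-shared-child-r u p' k k')
  parent-unique u (⊑-l p) ⊑-refl   k k' = ⊥-elim (no-shared-child-l u p k' k)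
  parent-unique u (⊑-r p) ⊑-refl   k k' = ⊥-elim (no-shared-child-r u p k' k)
  parent-unique u (⊑-l p) (⊑-l p') k k' = parent-unique (uniquelyNamed-l u) p p' k k'
  parent-unique u (⊑-r p) (⊑-r p') k k' = parent-unique (uniquelyNamed-r u) p p' k k'
  parent-unique u (⊑-l p) (⊑-r p') k k' =
    ⊥-elim (in-both-subtrees u (⊑-trans (child-⊑ k) p) (⊑-trans (child-⊑ k') p'))
  parent-unique u (⊑-r p) (⊑-l p') k k' =
    ⊥-elim (in-both-subtrees u (⊑-trans (child-⊑ k') p') (⊑-trans (child-⊑ k) p))

  child-pc : {t N c : BT n} → N ⊑ t → Child c N → ParentChild t (name N) (name c)
  child-pc {N = nd _ l r} N⊑t (inj₁ refl) = l , r , N⊑t , inj₁ refl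
  child-pc {N = nd _ l r} N⊑t (inj₂ refl) = l , r , N⊑t , inj₂ refl

  child-edge : {t N c : BT n} → N ⊑ t → Child c N → TEdge t (name N) (name c)
  child-edge N⊑t c◃N = inj₁ (child-pc N⊑t c◃N)

  child-edge′ : {t N c : BT n} {x y : ℕ} →
                N ⊑ t → Child c N → name N ≡ x → name c ≡ y → TEdge t x y
  child-edge′ N⊑t c◃N refl refl = child-edge N⊑t c◃N

  parentChild⇒child : {t : BT n} {x y : ℕ} → ParentChild t x y →
                      ∃[ N ] ∃[ c ] N ⊑ t × Child c N × name N ≡ x × name c ≡ y
  parentChild⇒child (l , r , N⊑t , inj₁ eq) = _ , l , N⊑t , inj₁ refl , refl , eq
  parentChild⇒child (l , r , N⊑t , inj₂ eq) = _ , r , N⊑t , inj₂ refl , refl , eq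

  TEdge-sym : {t : BT n} {x y : ℕ} → TEdge t x y → TEdge t y x
  TEdge-sym (inj₁ e) = inj₂ e
  TEdge-sym (inj₂ e) = inj₁ e

  TEdge-⊑ : {t t' : BT n} {x y : ℕ} → t ⊑ t' → TEdge t x y → TEdge t' x y
  TEdge-⊑ q (inj₁ (l , r , p , e)) = inj₁ (l , r , ⊑-trans p q , e)
  TEdge-⊑ q (inj₂ (l , r , p , e)) = inj₂ (l , r , ⊑-trans p q , e)

  neighbours : {t Q H : BT n} {w : ℕ} → UniquelyNamed t → Q ⊑ t → Child H Q → TEdge t w (name H) →
               w ≡ name Q ⊎ ∃[ c ] Child c H × w ≡ name c
  neighbours u Q⊑t H◃Q (inj₁ pc) with parentChild⇒child pc
  ... | N , c , N⊑t , c◃N , refl , eq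
    with name-injective u (⊑-trans (child-⊑ c◃N) N⊑t) (⊑-trans (child-⊑ H◃Q) Q⊑t) eq
  ... | refl = inj₁ (cong name (parent-unique u N⊑t Q⊑t c◃N H◃Q))
  neighbours u Q⊑t H◃Q (inj₂ pc) with parentChild⇒child pc
  ... | N , c , N⊑t , c◃N , eq , refl with name-injective u N⊑t (⊑-trans (child-⊑ H◃Q) Q⊑t) eq
  ... | refl = inj₂ (c , c◃N , refl)

  enter-subtree : {t H K : BT n} {x y : ℕ} → UniquelyNamed t → H ⊑ t → Child K H → TEdge t x y →
                  x ∉ names K → y ∈ names K → x ≡ name H
  enter-subtree u H⊑t K◃H (inj₁ pc) x∉K y∈K with parentChild⇒child pc
  ... | N , c , N⊑t , c◃N , refl , refl
    with ⊑-parent (∈names-⊑ u (⊑-trans (child-⊑ K◃H) H⊑t) (⊑-trans (child-⊑ c◃N) N⊑t) y∈K)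
  ... | inj₁ refl = cong name (parent-unique u N⊑t H⊑t c◃N K◃H)
  ... | inj₂ (M , M⊑K , c◃M)
    with parent-unique u N⊑t (⊑-trans M⊑K (⊑-trans (child-⊑ K◃H) H⊑t)) c◃N c◃M
  ... | refl = ⊥-elim (x∉K (name-⊑ M⊑K))
  enter-subtree u H⊑t K◃H (inj₂ pc) x∉K y∈K with parentChild⇒child pc
  ... | N , c , N⊑t , c◃N , refl , refl = ⊥-elim (x∉K (name-⊑ (⊑-trans (child-⊑ c◃N) N⊑K)))
    where N⊑K = ∈names-⊑ u (⊑-trans (child-⊑ K◃H) H⊑t) N⊑t y∈K

  Fork : BT n → ℕ → BT n → BT n → Set
  Fork N z x y = N ≡ nd z x y ⊎ N ≡ nd z y x

  module _ {N x y : BT n} {z : ℕ} where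

    fork-name : Fork N z x y → name N ≡ z
    fork-name (inj₁ refl) = refl
    fork-name (inj₂ refl) = refl

    fork-child₁ : Fork N z x y → Child x N
    fork-child₁ (inj₁ refl) = inj₁ refl
    fork-child₁ (inj₂ refl) = inj₂ refl

    fork-child₂ : Fork N z x y → Child y N
    fork-child₂ (inj₁ refl) = inj₂ refl
    fork-child₂ (inj₂ refl) = inj₁ refl

    fork-children : {c : BT n} → Fork N z x y → Child c N → c ≡ x ⊎ c ≡ y
    fork-children (inj₁ refl) c◃N       = c◃N
    fork-children (inj₂ refl) (inj₁ eq) = inj₂ eq
    fork-children (inj₂ refl) (inj₂ eq) = inj₁ eq

    fork-⊑ : {M : BT n} → Fork N z x y → M ⊑ N → M ≡ N ⊎ M ⊑ x ⊎ M ⊑ y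
    fork-⊑ _           ⊑-refl  = inj₁ refl
    fork-⊑ (inj₁ refl) (⊑-l p) = inj₂ (inj₁ p)
    fork-⊑ (inj₁ refl) (⊑-r p) = inj₂ (inj₂ p)
    fork-⊑ (inj₂ refl) (⊑-l p) = inj₂ (inj₂ p)
    fork-⊑ (inj₂ refl) (⊑-r p) = inj₂ (inj₁ p)

-- Walks and simple paths

Within : (ℕ → Set) → (ℕ → ℕ → Set) → ℕ → ℕ → Set
Within Q E x y = Q x × E x y × Q y

module _ {n : ℕ} where

  Path : BT n → (ℕ → Set) → ℕ → ℕ → Set
  Path t Q x z = Σ (List ℕ) λ is → Walk t x z is × Unique (x ∷ is ∷ʳ z) × All Q is

  module _ {t : BT n} {Q : ℕ → Set} where

    path-suffix : {x y z : ℕ} {is : List ℕ} → Walk t y z is → x ∈ y ∷ is →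
                  Unique (y ∷ is ∷ʳ z) → All Q is → Path t Q x z
    path-suffix W          (here refl) u       q       = _ , W , u , q
    path-suffix (step _ W) (there x∈)  (_ ∷ u) (_ ∷ q) = path-suffix W x∈ u q

    shortcut : {x z : ℕ} → Star (Within Q (TEdge t)) x z → x ≢ z → Path t Q x z
    shortcut ε x≢z = ⊥-elim (x≢z refl)
    shortcut {x} {z} (_◅_ {j = y} (_ , e , Qy) rest) x≢z with y ≟ z
    ... | yes refl = [] , edge e , (x≢z ∷ []) ∷ [] ∷ [] , []
    ... | no y≢z with shortcut rest y≢z
    ... | is , W , u , q with x ∈? y ∷ is
    ... | yes x∈ = path-suffix W x∈ u q
    ... | no x∉  = y ∷ is , step e W , All.∷ʳ⁺ (All.¬Any⇒All¬ (y ∷ is) x∉) x≢z ∷ u , Qy ∷ q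

    path-interior : {R : ℕ → Set} {x z : ℕ} → Path t Q x z →
                    (∀ {w} → w ≢ x → w ≢ z → Q w → R w) → Path t R x z
    path-interior (is , W , u , q) f =
      is , W , u , All.tabulate λ w∈ →
        let w≢x , w≢z = interior-distinct u w∈ in f w≢x w≢z (All.lookup q w∈)

  module _ {t : BT n} {R : ℕ → ℕ → Set} {ws : List ℕ}
           (f : ∀ {x y} → x ∈ ws → y ∈ ws → TEdge t x y → Star R x y) where

    walk-map : {x z : ℕ} {is : List ℕ} → Walk t x z is → x ∷ is ∷ʳ z ⊆ ws → Star R x z
    walk-map (edge e)   sub = f (sub (here refl)) (sub (there (here refl))) e
    walk-map (step e W) sub =
      f (sub (here refl)) (sub (there (here refl))) e ◅◅ walk-map W (λ m → sub (there m))

  reroute : {t t' : BT n} {R : ℕ → Set} {u v h : ℕ} {is : List ℕ} →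
            Walk t u v is → Unique (u ∷ is ∷ʳ v) → All R is → R h →
            (∀ {x y} → x ∈ u ∷ is ∷ʳ v → y ∈ u ∷ is ∷ʳ v → TEdge t x y →
               Star (Within (λ w → w ∈ u ∷ is ∷ʳ v ⊎ w ≡ h) (TEdge t')) x y) →
            Path t' R u v
  reroute {R = R} {u} {v} {h} {is} W uq Ris Rh f =
    path-interior (shortcut (walk-map f W (λ m → m)) (endpoints-distinct uq)) keep
    where
    keep : ∀ {w} → w ≢ u → w ≢ v → w ∈ u ∷ is ∷ʳ v ⊎ w ≡ h → R w
    keep w≢u w≢v (inj₁ w∈)   = All.lookup Ris (∈-interior w∈ w≢u w≢v)
    keep _   _   (inj₂ refl) = Rh

  first-step : {t : BT n} {x z : ℕ} {is : List ℕ} → Walk t x z is → ∃[ w ] w ∈ is ∷ʳ z × TEdge t x w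
  first-step (edge e)   = _ , here refl , e
  first-step (step e _) = _ , here refl , e

  interior-neighbours : {t : BT n} {x z h : ℕ} {is : List ℕ} →
                        Walk t x z is → Unique (x ∷ is ∷ʳ z) → h ∈ is →
                        ∃[ w₁ ] ∃[ w₂ ] w₁ ∈ x ∷ is ∷ʳ z × w₂ ∈ x ∷ is ∷ʳ z × w₁ ≢ w₂ ×
                                        TEdge t w₁ h × TEdge t h w₂
  interior-neighbours (step e W) (x∉ ∷ _) (here refl) with first-step W
  ... | w , w∈ , e' = _ , w , here refl , there (there w∈) , All.lookup x∉ (there w∈) , e , e'
  interior-neighbours (step e W) (_ ∷ u) (there h∈) with interior-neighbours W u h∈
  ... | w₁ , w₂ , w₁∈ , w₂∈ , rest = w₁ , w₂ , there w₁∈ , there w₂∈ , rest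

  module _ {t H K : BT n} (un : UniquelyNamed t) (H⊑t : H ⊑ t) (K◃H : Child K H) where

    exits-through : {x z : ℕ} {is : List ℕ} →
                    Walk t x z is → x ∈ names K → z ∉ names K → name H ∈ is ∷ʳ z
    exits-through (edge e) x∈ z∉ = here (sym (enter-subtree un H⊑t K◃H (TEdge-sym e) z∉ x∈))
    exits-through (step {c = c} e W) x∈ z∉ with c ∈? names K
    ... | yes c∈ = there (exits-through W c∈ z∉)
    ... | no c∉  = here (sym (enter-subtree un H⊑t K◃H (TEdge-sym e) c∉ x∈))

    -- A simple walk that enters the subtree at K must leave it through H again, repeating H.
    avoids-subtree : {x z : ℕ} {is : List ℕ} → Walk t x z is → Unique (x ∷ is ∷ʳ z) →
                     x ∉ names K → z ∉ names K → All (_∉ names K) (x ∷ is ∷ʳ z)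
    avoids-subtree (edge e) _ x∉ z∉ = x∉ ∷ z∉ ∷ []
    avoids-subtree (step {c = c} e W) (x∉rest ∷ u) x∉ z∉ with c ∈? names K
    ... | no c∉  = x∉ ∷ avoids-subtree W u c∉ z∉
    ... | yes c∈ with enter-subtree un H⊑t K◃H e x∉ c∈
    ... | refl = ⊥-elim (All.lookup x∉rest (there (exits-through W c∈ z∉)) refl)

  path-through-fork : {t Q H O K : BT n} {h u v : ℕ} {is : List ℕ} →
                      UniquelyNamed t → Q ⊑ t → Child H Q → Fork H h O K →
                      Walk t u v is → Unique (u ∷ is ∷ʳ v) → u ∉ names K → v ∉ names K → h ∈ is →
                      name Q ∈ u ∷ is ∷ʳ v × name O ∈ u ∷ is ∷ʳ v
  path-through-fork {t} {Q} {H} {O} {K} {h} {u} {v} {is} un Q⊑t H◃Q fork W uq u∉ v∉ h∈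
    with interior-neighbours W uq h∈
  ... | w₁ , w₂ , w₁∈ , w₂∈ , w₁≢w₂ , e₁ , e₂ = both (beside w₁∈ e₁) (beside w₂∈ (TEdge-sym e₂))
    where
    ws = u ∷ is ∷ʳ v

    beside : ∀ {w} → w ∈ ws → TEdge t w h → w ≡ name Q ⊎ w ≡ name O
    beside w∈ e with neighbours un Q⊑t H◃Q (subst (TEdge t _) (sym (fork-name fork)) e)
    ... | inj₁ w≡Q = inj₁ w≡Q
    ... | inj₂ (c , c◃H , refl) with fork-children fork c◃H
    ... | inj₁ refl = inj₂ refl
    ... | inj₂ refl = ⊥-elim (All.lookup outside-K w∈ (name∈names K))
      where outside-K = avoids-subtree un (⊑-trans (child-⊑ H◃Q) Q⊑t) (fork-child₂ fork) W uq u∉ v∉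

    both : w₁ ≡ name Q ⊎ w₁ ≡ name O → w₂ ≡ name Q ⊎ w₂ ≡ name O →
           name Q ∈ ws × name O ∈ ws
    both (inj₁ p) (inj₂ q) = subst (_∈ ws) p w₁∈ , subst (_∈ ws) q w₂∈
    both (inj₂ p) (inj₁ q) = subst (_∈ ws) q w₂∈ , subst (_∈ ws) p w₁∈
    both (inj₁ p) (inj₁ q) = ⊥-elim (w₁≢w₂ (trans p (sym q)))
    both (inj₂ p) (inj₂ q) = ⊥-elim (w₁≢w₂ (trans p (sym q)))

-- Swaps

module ↭ = CommutativeSemigroupProperties
  (CommutativeMonoid.commutativeSemigroup (++-commutativeMonoid {A = ℕ}))

module _ {n : ℕ} where

  -- Notation: v₁ v₂ v₃ are the paper's v₁' v₂' v₃.  Here s is the subtree at the paper's v₁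
  -- (named a), with children B (at v₂, named b) and v₁'.  After the swap, s' is the subtree at v₂,
  -- with children A' (at v₁) and v₂'.
  record Swap1Forks (s s' v₁ v₂ v₃ : BT n) : Set where
    constructor forks
    field
      a b     : ℕ
      B A'    : BT n
      A-fork  : Fork s a B v₁
      B-fork  : Fork B b v₃ v₂
      B'-fork : Fork s' b A' v₂
      A'-fork : Fork A' a v₃ v₁

    A'⊑s' : A' ⊑ s'
    A'⊑s' = child-⊑ (fork-child₁ B'-fork)

    v₁⊑s' : v₁ ⊑ s'
    v₁⊑s' = ⊑-trans (child-⊑ (fork-child₂ A'-fork)) A'⊑s'

    v₂⊑s' : v₂ ⊑ s'
    v₂⊑s' = child-⊑ (fork-child₂ B'-fork)

    v₃⊑s' : v₃ ⊑ s'
    v₃⊑s' = ⊑-trans (child-⊑ (fork-child₁ A'-fork)) A'⊑s'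

    name-A' : name A' ≡ name s
    name-A' = trans (fork-name A'-fork) (sym (fork-name A-fork))

    name-s' : name s' ≡ name B
    name-s' = trans (fork-name B'-fork) (sym (fork-name B-fork))

    edge-ba : TEdge s' b a
    edge-ba = child-edge′ ⊑-refl (fork-child₁ B'-fork) (fork-name B'-fork) (fork-name A'-fork)

    edge-av₃ : TEdge s' a (name v₃)
    edge-av₃ = child-edge′ A'⊑s' (fork-child₁ A'-fork) (fork-name A'-fork) refl

    swap1-edge : ∀ {N c} → N ⊑ s → Child c N →
                 TEdge s' (name N) (name c) ⊎ (name N ≡ b × name c ≡ name v₃)
    swap1-edge N⊑s c◃N with fork-⊑ A-fork N⊑s
    ... | inj₂ (inj₂ N⊑v₁) = inj₁ (child-edge (⊑-trans N⊑v₁ v₁⊑s') c◃N)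
    ... | inj₁ refl with fork-children A-fork c◃N
    ...   | inj₁ refl = inj₁ (TEdge-sym (child-edge′ ⊑-refl (fork-child₁ B'-fork) name-s' name-A'))
    ...   | inj₂ refl = inj₁ (child-edge′ A'⊑s' (fork-child₂ A'-fork) name-A' refl)
    swap1-edge N⊑s c◃N | inj₂ (inj₁ N⊑B) with fork-⊑ B-fork N⊑B
    ... | inj₂ (inj₁ N⊑v₃) = inj₁ (child-edge (⊑-trans N⊑v₃ v₃⊑s') c◃N)
    ... | inj₂ (inj₂ N⊑v₂) = inj₁ (child-edge (⊑-trans N⊑v₂ v₂⊑s') c◃N)
    ... | inj₁ refl with fork-children B-fork c◃N
    ...   | inj₁ refl = inj₂ (fork-name B-fork , refl)
    ...   | inj₂ refl = inj₁ (child-edge′ ⊑-refl (fork-child₂ B'-fork) name-s' refl)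

  swap1-forks : {s s' v₁ v₂ v₃ : BT n} → Swap1 s s' v₁ v₂ v₃ → Swap1Forks s s' v₁ v₂ v₃
  swap1-forks (LL a b _ _ _) = forks a b _ _ (inj₁ refl) (inj₁ refl) (inj₁ refl) (inj₁ refl)
  swap1-forks (LR a b _ _ _) = forks a b _ _ (inj₁ refl) (inj₂ refl) (inj₂ refl) (inj₁ refl)
  swap1-forks (RL a b _ _ _) = forks a b _ _ (inj₂ refl) (inj₁ refl) (inj₁ refl) (inj₂ refl)
  swap1-forks (RR a b _ _ _) = forks a b _ _ (inj₂ refl) (inj₂ refl) (inj₂ refl) (inj₂ refl)

  swap1-reverse : {s s' v₁ v₂ v₃ : BT n} → Swap1 s s' v₁ v₂ v₃ → Swap1 s' s v₂ v₁ v₃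
  swap1-reverse (LL a b v₁ v₂ v₃) = LL b a v₂ v₁ v₃
  swap1-reverse (LR a b v₁ v₂ v₃) = RL b a v₂ v₁ v₃
  swap1-reverse (RL a b v₁ v₂ v₃) = LR b a v₂ v₁ v₃
  swap1-reverse (RR a b v₁ v₂ v₃) = RR b a v₂ v₁ v₃

  swap-reverse : {T T' v₁ v₂ v₃ : BT n} → Swap T T' v₁ v₂ v₃ → Swap T' T v₂ v₁ v₃
  swap-reverse (hereL sw)  = hereL (swap1-reverse sw)
  swap-reverse (hereR sw)  = hereR (swap1-reverse sw)
  swap-reverse (thereL sw) = thereL (swap-reverse sw)
  swap-reverse (thereR sw) = thereR (swap-reverse sw)

  swap-name : {T T' v₁ v₂ v₃ : BT n} → Swap T T' v₁ v₂ v₃ → name T ≡ name T'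
  swap-name (hereL _)  = refl
  swap-name (hereR _)  = refl
  swap-name (thereL _) = refl
  swap-name (thereR _) = refl

  fork-names : {N x y : BT n} {z : ℕ} → Fork N z x y → names N ↭ z ∷ names x ++ names y
  fork-names             (inj₁ refl) = ↭-refl
  fork-names {x = x} {y} (inj₂ refl) = prep _ (++-comm (names y) (names x))

  swap1-names : {s s' v₁ v₂ v₃ : BT n} → Swap1Forks s s' v₁ v₂ v₃ → names s ↭ names s'
  swap1-names {s} {s'} {v₁} {v₂} {v₃} (forks a b B A' A-fork B-fork B'-fork A'-fork) = begin
    names s                                      ↭⟨ fork-names A-fork ⟩
    a ∷ names B ++ names v₁                      ↭⟨ prep a (++⁺ʳ (names v₁) (fork-names B-fork)) ⟩
    a ∷ b ∷ (names v₃ ++ names v₂) ++ names v₁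
      ↭⟨ swap a b (↭.xy∙z≈xz∙y (names v₃) (names v₂) (names v₁)) ⟩
    b ∷ a ∷ (names v₃ ++ names v₁) ++ names v₂
      ↭⟨ prep b (++⁺ʳ (names v₂) (fork-names A'-fork)) ⟨
    b ∷ names A' ++ names v₂                     ↭⟨ fork-names B'-fork ⟨
    names s'                                     ∎
    where open PermutationReasoning

  swap-names : {T T' v₁ v₂ v₃ : BT n} → Swap T T' v₁ v₂ v₃ → names T ↭ names T'
  swap-names (hereL  {c} {r = r} sw) = prep c (++⁺ʳ (names r) (swap1-names (swap1-forks sw)))
  swap-names (hereR  {c} {l}     sw) = prep c (++⁺ˡ (names l) (swap1-names (swap1-forks sw)))
  swap-names (thereL {c} {r = r} sw) = prep c (++⁺ʳ (names r) (swap-names sw))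
  swap-names (thereR {c} {l}     sw) = prep c (++⁺ˡ (names l) (swap-names sw))

  uniquelyNamed-swap : {T T' v₁ v₂ v₃ : BT n} →
                       Swap T T' v₁ v₂ v₃ → UniquelyNamed T → UniquelyNamed T'
  uniquelyNamed-swap sw = unique-↭ (swap-names sw)

  -- In T the swap path is P A B v₃ (the paper's v₀v₁v₂v₃).  Replaced lists its edges v₀v₁ and
  -- v₂v₃, which T' lacks; T' has v₀v₂, v₂v₁ and v₁v₃ instead (edge-pb, edge-ba, edge-av₃).
  Replaced : ℕ → ℕ → ℕ → ℕ → ℕ → ℕ → Set
  Replaced p a b w x y = (x ≡ p × y ≡ a) ⊎ (x ≡ b × y ≡ w)

  record SwapSite (T T' v₁ v₂ v₃ : BT n) : Set where
    field
      P A B  : BT n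
      a b    : ℕ
      P⊑T    : P ⊑ T
      A◃P    : Child A P
      A-fork : Fork A a B v₁
      B-fork : Fork B b v₃ v₂
      edge-pb  : TEdge T' (name P) b
      edge-ba  : TEdge T' b a
      edge-av₃ : TEdge T' a (name v₃)
      edge-image : ∀ {x y} → ParentChild T x y → TEdge T' x y ⊎ Replaced (name P) a b (name v₃) x y

  module _ {X : ℕ → ℕ → Set} {c : ℕ} where

    edges-left : {l l' r : BT n} → TEdge (nd c l' r) c (name l) ⊎ X c (name l) →
                 (∀ {N d} → N ⊑ l → Child d N → TEdge l' (name N) (name d) ⊎ X (name N) (name d)) →
                 ∀ {x y} → ParentChild (nd c l r) x y → TEdge (nd c l' r) x y ⊎ X x y
    edges-left root inner pc with parentChild⇒child pc
    ... | _ , _ , ⊑-refl   , inj₁ refl , refl , refl = root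
    ... | _ , _ , ⊑-refl   , inj₂ refl , refl , refl = inj₁ (child-edge ⊑-refl (inj₂ refl))
    ... | _ , _ , ⊑-r N⊑r , d◃N       , refl , refl = inj₁ (child-edge (⊑-r N⊑r) d◃N)
    ... | _ , _ , ⊑-l N⊑l , d◃N       , refl , refl = Sum.map₁ (TEdge-⊑ (⊑-l ⊑-refl)) (inner N⊑l d◃N)

    edges-right : {l r r' : BT n} → TEdge (nd c l r') c (name r) ⊎ X c (name r) →
                  (∀ {N d} → N ⊑ r → Child d N → TEdge r' (name N) (name d) ⊎ X (name N) (name d)) →
                  ∀ {x y} → ParentChild (nd c l r) x y → TEdge (nd c l r') x y ⊎ X x y
    edges-right root inner pc with parentChild⇒child pc
    ... | _ , _ , ⊑-refl   , inj₂ refl , refl , refl = root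
    ... | _ , _ , ⊑-refl   , inj₁ refl , refl , refl = inj₁ (child-edge ⊑-refl (inj₁ refl))
    ... | _ , _ , ⊑-l N⊑l , d◃N       , refl , refl = inj₁ (child-edge (⊑-l N⊑l) d◃N)
    ... | _ , _ , ⊑-r N⊑r , d◃N       , refl , refl = Sum.map₁ (TEdge-⊑ (⊑-r ⊑-refl)) (inner N⊑r d◃N)

  swap-site : {T T' v₁ v₂ v₃ : BT n} → Swap T T' v₁ v₂ v₃ → SwapSite T T' v₁ v₂ v₃
  swap-site {v₃ = v₃} (hereL {c} {l} {l'} {r} sw) = record
    { P = nd c l r ; A = l ; B = B ; a = a ; b = b
    ; P⊑T = ⊑-refl ; A◃P = inj₁ refl ; A-fork = A-fork ; B-fork = B-fork
    ; edge-pb   = child-edge′ ⊑-refl (inj₁ refl) refl (fork-name B'-fork)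
    ; edge-ba   = TEdge-⊑ (⊑-l ⊑-refl) edge-ba
    ; edge-av₃  = TEdge-⊑ (⊑-l ⊑-refl) edge-av₃
    ; edge-image = edges-left {Replaced c a b (name v₃)} (inj₂ (inj₁ (refl , fork-name A-fork)))
                              λ N⊑l d◃N → Sum.map₂ inj₂ (swap1-edge N⊑l d◃N)
    }
    where open Swap1Forks (swap1-forks sw)
  swap-site {v₃ = v₃} (hereR {c} {l} {r} {r'} sw) = record
    { P = nd c l r ; A = r ; B = B ; a = a ; b = b
    ; P⊑T = ⊑-refl ; A◃P = inj₂ refl ; A-fork = A-fork ; B-fork = B-fork
    ; edge-pb   = child-edge′ ⊑-refl (inj₂ refl) refl (fork-name B'-fork)
    ; edge-ba   = TEdge-⊑ (⊑-r ⊑-refl) edge-ba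
    ; edge-av₃  = TEdge-⊑ (⊑-r ⊑-refl) edge-av₃
    ; edge-image = edges-right {Replaced c a b (name v₃)} (inj₂ (inj₁ (refl , fork-name A-fork)))
                               λ N⊑r d◃N → Sum.map₂ inj₂ (swap1-edge N⊑r d◃N)
    }
    where open Swap1Forks (swap1-forks sw)
  swap-site {v₃ = v₃} (thereL {c} {l} {l'} {r} sw) = record
    { P = P ; A = A ; B = B ; a = a ; b = b
    ; P⊑T = ⊑-l P⊑T ; A◃P = A◃P ; A-fork = A-fork ; B-fork = B-fork
    ; edge-pb   = TEdge-⊑ (⊑-l ⊑-refl) edge-pb
    ; edge-ba   = TEdge-⊑ (⊑-l ⊑-refl) edge-ba
    ; edge-av₃  = TEdge-⊑ (⊑-l ⊑-refl) edge-av₃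
    ; edge-image = edges-left {Replaced (name P) a b (name v₃)}
                              (inj₁ (child-edge′ ⊑-refl (inj₁ refl) refl (sym (swap-name sw))))
                              λ N⊑l d◃N → edge-image (child-pc N⊑l d◃N)
    }
    where open SwapSite (swap-site sw)
  swap-site {v₃ = v₃} (thereR {c} {l} {r} {r'} sw) = record
    { P = P ; A = A ; B = B ; a = a ; b = b
    ; P⊑T = ⊑-r P⊑T ; A◃P = A◃P ; A-fork = A-fork ; B-fork = B-fork
    ; edge-pb   = TEdge-⊑ (⊑-r ⊑-refl) edge-pb
    ; edge-ba   = TEdge-⊑ (⊑-r ⊑-refl) edge-ba
    ; edge-av₃  = TEdge-⊑ (⊑-r ⊑-refl) edge-av₃
    ; edge-image = edges-right {Replaced (name P) a b (name v₃)}
                               (inj₁ (child-edge′ ⊑-refl (inj₂ refl) refl (sym (swap-name sw))))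
                               λ N⊑r d◃N → edge-image (child-pc N⊑r d◃N)
    }
    where open SwapSite (swap-site sw)

-- Full, empty and mixed subtrees

data Kind : Set where
  full empty mixed : Kind

infixl 6 _⊔_

_⊔_ : Kind → Kind → Kind
full  ⊔ full  = full
empty ⊔ empty = empty
_     ⊔ _     = mixed

⊔-comm : ∀ a b → a ⊔ b ≡ b ⊔ a
⊔-comm full  full  = refl
⊔-comm full  empty = refl
⊔-comm full  mixed = refl
⊔-comm empty full  = refl
⊔-comm empty empty = refl
⊔-comm empty mixed = refl
⊔-comm mixed full  = refl
⊔-comm mixed empty = refl
⊔-comm mixed mixed = refl

⊔-assoc : ∀ a b c → (a ⊔ b) ⊔ c ≡ a ⊔ (b ⊔ c)
⊔-assoc full  full  full  = refl
⊔-assoc full  full  empty = refl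
⊔-assoc full  full  mixed = refl
⊔-assoc full  empty full  = refl
⊔-assoc full  empty empty = refl
⊔-assoc full  empty mixed = refl
⊔-assoc full  mixed _     = refl
⊔-assoc empty full  full  = refl
⊔-assoc empty full  empty = refl
⊔-assoc empty full  mixed = refl
⊔-assoc empty empty full  = refl
⊔-assoc empty empty empty = refl
⊔-assoc empty empty mixed = refl
⊔-assoc empty mixed _     = refl
⊔-assoc mixed _     _     = refl

⊔-commutativeSemigroup : CommutativeSemigroup _ _
⊔-commutativeSemigroup = record
  { isCommutativeSemigroup = record
    { isSemigroup = record { isMagma = isMagma _⊔_ ; assoc = ⊔-assoc }
    ; comm        = ⊔-comm
    }
  }

module ⊔ = CommutativeSemigroupProperties ⊔-commutativeSemigroup

⊔≡full⁻ : ∀ a b → a ⊔ b ≡ full → a ≡ full × b ≡ full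
⊔≡full⁻ full  full  _  = refl , refl
⊔≡full⁻ full  empty ()
⊔≡full⁻ full  mixed ()
⊔≡full⁻ empty full  ()
⊔≡full⁻ empty empty ()
⊔≡full⁻ empty mixed ()
⊔≡full⁻ mixed _     ()

⊔≡empty⁻ : ∀ a b → a ⊔ b ≡ empty → a ≡ empty × b ≡ empty
⊔≡empty⁻ empty empty _  = refl , refl
⊔≡empty⁻ full  full  ()
⊔≡empty⁻ full  empty ()
⊔≡empty⁻ full  mixed ()
⊔≡empty⁻ empty full  ()
⊔≡empty⁻ empty mixed ()
⊔≡empty⁻ mixed _     ()

skeletal : Kind → Kind → Bool
skeletal full  empty = true
skeletal empty full  = true
skeletal mixed mixed = true
skeletal _     _     = false

skeletal-comm : ∀ a b → skeletal a b ≡ skeletal b a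
skeletal-comm full  full  = refl
skeletal-comm full  empty = refl
skeletal-comm full  mixed = refl
skeletal-comm empty full  = refl
skeletal-comm empty empty = refl
skeletal-comm empty mixed = refl
skeletal-comm mixed full  = refl
skeletal-comm mixed empty = refl
skeletal-comm mixed mixed = refl

data Absorbs : Kind → Kind → Set where
  full-full   : Absorbs full  full
  empty-empty : Absorbs empty empty
  mixed-full  : Absorbs mixed full
  mixed-empty : Absorbs mixed empty

absorbed-pure : ∀ {k c} → Absorbs k c → c ≡ full ⊎ c ≡ empty
absorbed-pure full-full   = inj₁ refl
absorbed-pure empty-empty = inj₂ refl
absorbed-pure mixed-full  = inj₁ refl
absorbed-pure mixed-empty = inj₂ refl

absorbs-¬skeletal : ∀ {k c} → Absorbs k c → skeletal k c ≡ false
absorbs-¬skeletal full-full   = refl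
absorbs-¬skeletal empty-empty = refl
absorbs-¬skeletal mixed-full  = refl
absorbs-¬skeletal mixed-empty = refl

absorbs-skeletal : ∀ {k c} → Absorbs k c → ∀ j →
                   skeletal (k ⊔ c) j ≡ skeletal k j × skeletal (k ⊔ j) c ≡ skeletal k c
absorbs-skeletal full-full   full  = refl , refl
absorbs-skeletal full-full   empty = refl , refl
absorbs-skeletal full-full   mixed = refl , refl
absorbs-skeletal empty-empty full  = refl , refl
absorbs-skeletal empty-empty empty = refl , refl
absorbs-skeletal empty-empty mixed = refl , refl
absorbs-skeletal mixed-full  _     = refl , refl
absorbs-skeletal mixed-empty _     = refl , refl

absorbing-skeletal : ∀ {c₁ c₂ k} → Absorbs k c₂ ⊎ Absorbs k c₁ →
                     skeletal (k ⊔ c₂) c₁ ≡ skeletal k c₁ × skeletal (k ⊔ c₁) c₂ ≡ skeletal k c₂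
absorbing-skeletal {c₁}      (inj₁ k▹c₂) = absorbs-skeletal k▹c₂ c₁
absorbing-skeletal {c₂ = c₂} (inj₂ k▹c₁) = Product.swap (absorbs-skeletal k▹c₁ c₂)

Laminar : {n : ℕ} → (Fin n → Set) → (Fin n → Set) → Set
Laminar X Y = (∀ {e} → X e → Y e) ⊎ (∀ {e} → Y e → X e) ⊎ (∀ {e} → X e → ¬ Y e)

fam-laminar : {n : ℕ} {t x y : BT n} → Unique (leaves t) → x ⊑ t → y ⊑ t → Laminar (Fam x) (Fam y)
fam-laminar u ⊑-refl    y⊑t    = inj₂ (inj₁ (leaves-⊑ y⊑t))
fam-laminar u x⊑t@(⊑-l _) ⊑-refl = inj₁ (leaves-⊑ x⊑t)
fam-laminar u x⊑t@(⊑-r _) ⊑-refl = inj₁ (leaves-⊑ x⊑t)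
fam-laminar {t = nd _ l _} u (⊑-l x⊑l) (⊑-l y⊑l) = fam-laminar (unique-++ˡ (leaves l) u) x⊑l y⊑l
fam-laminar {t = nd _ l _} u (⊑-r x⊑r) (⊑-r y⊑r) = fam-laminar (unique-++ʳ (leaves l) u) x⊑r y⊑r
fam-laminar {t = nd _ l _} u (⊑-l x⊑l) (⊑-r y⊑r) =
  inj₂ (inj₂ λ ex ey → unique-++-disjoint (leaves l) u (leaves-⊑ x⊑l ex) (leaves-⊑ y⊑r ey))
fam-laminar {t = nd _ l _} u (⊑-r x⊑r) (⊑-l y⊑l) =
  inj₂ (inj₂ λ ex ey → unique-++-disjoint (leaves l) u (leaves-⊑ y⊑l ey) (leaves-⊑ x⊑r ex))

module Kinds {n : ℕ} (S : Fin n → Set) (S? : ∀ e → Dec (S e)) where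

  leafKind : ∀ {e} → Dec (S e) → Kind
  leafKind (yes _) = full
  leafKind (no _)  = empty

  kind : BT n → Kind
  kind (lf _ e)   = leafKind (S? e)
  kind (nd _ l r) = kind l ⊔ kind r

  isSkeletal : BT n → Bool
  isSkeletal (lf _ _)   = false
  isSkeletal (nd _ l r) = skeletal (kind l) (kind r)

  Point : BT n → Set
  Point s = LeafPoint S s ⊎ BranchPoint S s

  Full⇒full : ∀ t → Full S t → kind t ≡ full
  Full⇒full (lf _ e) f with S? e
  ... | yes _ = refl
  ... | no ¬s = ⊥-elim (¬s (f (here refl)))
  Full⇒full (nd _ l r) f
    rewrite Full⇒full l (f ∘ ∈-++⁺ˡ) | Full⇒full r (f ∘ ∈-++⁺ʳ (leaves l)) = refl

  Empty⇒empty : ∀ t → Empty S t → kind t ≡ empty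
  Empty⇒empty (lf _ e) f with S? e
  ... | yes s = ⊥-elim (f (here refl) s)
  ... | no _  = refl
  Empty⇒empty (nd _ l r) f
    rewrite Empty⇒empty l (f ∘ ∈-++⁺ˡ) | Empty⇒empty r (f ∘ ∈-++⁺ʳ (leaves l)) = refl

  full⇒Full : ∀ t → kind t ≡ full → Full S t
  full⇒Full (lf _ e) eq (here refl) with S? e | eq
  ... | yes s | _  = s
  ... | no _  | ()
  full⇒Full (nd _ l r) eq e∈ with ⊔≡full⁻ (kind l) (kind r) eq | ∈-++⁻ (leaves l) e∈
  ... | fl , _ | inj₁ e∈l = full⇒Full l fl e∈l
  ... | _ , fr | inj₂ e∈r = full⇒Full r fr e∈r

  empty⇒Empty : ∀ t → kind t ≡ empty → Empty S t
  empty⇒Empty (lf _ e) eq (here refl) with S? e | eq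
  ... | no ¬s | _ = ¬s
  ... | yes _ | ()
  empty⇒Empty (nd _ l r) eq e∈ with ⊔≡empty⁻ (kind l) (kind r) eq | ∈-++⁻ (leaves l) e∈
  ... | el , _ | inj₁ e∈l = empty⇒Empty l el e∈l
  ... | _ , er | inj₂ e∈r = empty⇒Empty r er e∈r

  Mixed⇒mixed : ∀ t → Mixed S t → kind t ≡ mixed
  Mixed⇒mixed t (¬f , ¬e) with kind t in eq
  ... | full  = ⊥-elim (¬f (full⇒Full t eq))
  ... | empty = ⊥-elim (¬e (empty⇒Empty t eq))
  ... | mixed = refl

  mixed⇒Mixed : ∀ t → kind t ≡ mixed → Mixed S t
  mixed⇒Mixed t eq =
    (λ f → full≢mixed (trans (sym (Full⇒full t f)) eq)) ,
    (λ e → empty≢mixed (trans (sym (Empty⇒empty t e)) eq))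
    where
    full≢mixed : ¬ full ≡ mixed
    full≢mixed ()
    empty≢mixed : ¬ empty ≡ mixed
    empty≢mixed ()

  point⇒skeletal : ∀ s → Point s → isSkeletal s ≡ true
  point⇒skeletal (nd _ l r) (inj₁ (inj₁ (el , fr))) rewrite Empty⇒empty l el | Full⇒full r fr = refl
  point⇒skeletal (nd _ l r) (inj₁ (inj₂ (fl , er))) rewrite Full⇒full l fl | Empty⇒empty r er = refl
  point⇒skeletal (nd _ l r) (inj₂ (ml , mr))        rewrite Mixed⇒mixed l ml | Mixed⇒mixed r mr = refl

  skeletal⇒point : ∀ s → isSkeletal s ≡ true → Point s
  skeletal⇒point (nd _ l r) eq with kind l in el | kind r in er
  ... | empty | full  = inj₁ (inj₁ (empty⇒Empty l el , full⇒Full r er))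
  ... | full  | empty = inj₁ (inj₂ (full⇒Full l el , empty⇒Empty r er))
  ... | mixed | mixed = inj₂ (mixed⇒Mixed l el , mixed⇒Mixed r er)
  skeletal⇒point (nd _ l r) () | full  | full
  skeletal⇒point (nd _ l r) () | full  | mixed
  skeletal⇒point (nd _ l r) () | empty | empty
  skeletal⇒point (nd _ l r) () | empty | mixed
  skeletal⇒point (nd _ l r) () | mixed | full
  skeletal⇒point (nd _ l r) () | mixed | empty

  Pure : BT n → Set
  Pure t = Full S t ⊎ Empty S t

  pure-not-skeletal : ∀ {s t} → Pure t → s ⊑ t → isSkeletal s ≡ false
  pure-not-skeletal {lf _ _}   _         _   = refl
  pure-not-skeletal {nd a l r} (inj₁ f) s⊑t
    with ⊔≡full⁻ (kind l) (kind r) (Full⇒full (nd a l r) λ e∈ → f (leaves-⊑ s⊑t e∈))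
  ... | fl , fr rewrite fl | fr = refl
  pure-not-skeletal {nd a l r} (inj₂ e) s⊑t
    with ⊔≡empty⁻ (kind l) (kind r) (Empty⇒empty (nd a l r) λ e∈ → e (leaves-⊑ s⊑t e∈))
  ... | el , er rewrite el | er = refl

  nonskeletal-¬point : ∀ {s} → isSkeletal s ≡ false → ¬ Point s
  nonskeletal-¬point {s} eq pt with trans (sym (point⇒skeletal s pt)) eq
  ... | ()

  skelNode∉pure : ∀ {T K z} → UniquelyNamed T → K ⊑ T → Pure K → SkelNode S T z → z ∉ names K
  skelNode∉pure un K⊑T pure (s , s⊑T , refl , pt) z∈K =
    nonskeletal-¬point (pure-not-skeletal pure (∈names-⊑ un K⊑T s⊑T z∈K)) pt

  ¬skelNode : ∀ {T N} → UniquelyNamed T → N ⊑ T → isSkeletal N ≡ false → ¬ SkelNode S T (name N)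
  ¬skelNode un N⊑T N-nonskeletal (s , s⊑T , eq , pt) with name-injective un s⊑T N⊑T eq
  ... | refl = nonskeletal-¬point N-nonskeletal pt

  fork-kind : ∀ {N x y z} → Fork N z x y → kind N ≡ kind x ⊔ kind y
  fork-kind             (inj₁ refl) = refl
  fork-kind {x = x} {y} (inj₂ refl) = ⊔-comm (kind y) (kind x)

  fork-skeletal : ∀ {N x y z} → Fork N z x y → isSkeletal N ≡ skeletal (kind x) (kind y)
  fork-skeletal             (inj₁ refl) = refl
  fork-skeletal {x = x} {y} (inj₂ refl) = skeletal-comm (kind y) (kind x)

  Absorbing : BT n → BT n → BT n → Set
  Absorbing v₁ v₂ v₃ = Absorbs (kind v₃) (kind v₂) ⊎ Absorbs (kind v₃) (kind v₁)

  full-absorbed : ∀ {v w} → Full S v → ¬ Empty S w → Absorbs (kind w) (kind v)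
  full-absorbed {v} {w} fv ¬ew rewrite Full⇒full v fv with kind w in eq
  ... | full  = full-full
  ... | mixed = mixed-full
  ... | empty = ⊥-elim (¬ew (empty⇒Empty w eq))

  empty-absorbed : ∀ {v w} → Empty S v → ¬ Full S w → Absorbs (kind w) (kind v)
  empty-absorbed {v} {w} ev ¬fw rewrite Empty⇒empty v ev with kind w in eq
  ... | empty = empty-empty
  ... | mixed = mixed-empty
  ... | full  = ⊥-elim (¬fw (full⇒Full w eq))

  absorbing-side : ∀ {X : Fin n → Set} {v₁ v₂ v₃} → Laminar X S → Mixed X v₃ →
                   (Empty X v₁ × Full X v₂) ⊎ (Full X v₁ × Empty X v₂) → Absorbing v₁ v₂ v₃
  absorbing-side {X} {v₁} {v₂} {v₃} (inj₁ X⊆S) (_ , ¬eX) side =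
    Sum.map (absorbed v₂) (absorbed v₁) (Sum.map proj₂ proj₁ side)
    where
    absorbed : ∀ v → Full X v → Absorbs (kind v₃) (kind v)
    absorbed v fv = full-absorbed {v} {v₃} (λ e∈ → X⊆S (fv e∈)) (λ eS → ¬eX λ e∈ x → eS e∈ (X⊆S x))
  absorbing-side {X} {v₁} {v₂} {v₃} (inj₂ (inj₁ S⊆X)) (¬fX , _) side =
    Sum.map (absorbed v₂) (absorbed v₁) (Sum.swap (Sum.map proj₁ proj₂ side))
    where
    absorbed : ∀ v → Empty X v → Absorbs (kind v₃) (kind v)
    absorbed v ev = empty-absorbed {v} {v₃} (λ e∈ s → ev e∈ (S⊆X s)) (λ fS → ¬fX λ e∈ → S⊆X (fS e∈))
  absorbing-side {X} {v₁} {v₂} {v₃} (inj₂ (inj₂ X∩S=∅)) (_ , ¬eX) side =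
    Sum.map (absorbed v₂) (absorbed v₁) (Sum.map proj₂ proj₁ side)
    where
    absorbed : ∀ v → Full X v → Absorbs (kind v₃) (kind v)
    absorbed v fv = empty-absorbed {v} {v₃} (λ e∈ → X∩S=∅ (fv e∈)) (λ fS → ¬eX λ e∈ x → X∩S=∅ x (fS e∈))

  Corresponds : BT n → BT n → Set
  Corresponds T T' = ∀ {s} → s ⊑ T → ∃[ s' ] s' ⊑ T' × name s' ≡ name s × isSkeletal s' ≡ isSkeletal s

  corresponds-skelNode : ∀ {T T' z} → Corresponds T T' → SkelNode S T z → SkelNode S T' z
  corresponds-skelNode corr (s , s⊑T , refl , pt) with corr s⊑T
  ... | s' , s'⊑T' , eq , sk = s' , s'⊑T' , eq , skeletal⇒point s' (trans sk (point⇒skeletal s pt))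

  module _ {c : ℕ} where

    corresponds-left : ∀ {l l' r} → kind l ≡ kind l' → Corresponds l l' →
                       Corresponds (nd c l r) (nd c l' r)
    corresponds-left {r = r} eq corr ⊑-refl = _ , ⊑-refl , refl , cong (λ k → skeletal k (kind r)) (sym eq)
    corresponds-left         eq corr (⊑-r p) = _ , ⊑-r p , refl , refl
    corresponds-left         eq corr (⊑-l p) = let s' , q , same = corr p in s' , ⊑-l q , same

    corresponds-right : ∀ {l r r'} → kind r ≡ kind r' → Corresponds r r' →
                        Corresponds (nd c l r) (nd c l r')
    corresponds-right {l} eq corr ⊑-refl = _ , ⊑-refl , refl , cong (skeletal (kind l)) (sym eq)
    corresponds-right     eq corr (⊑-l p) = _ , ⊑-l p , refl , refl
    corresponds-right     eq corr (⊑-r p) = let s' , q , same = corr p in s' , ⊑-r q , same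

  module _ {s s' v₁ v₂ v₃ : BT n} (F : Swap1Forks s s' v₁ v₂ v₃) where
    open Swap1Forks F
    open ≡-Reasoning

    kind-swap1 : kind s ≡ kind s'
    kind-swap1 = begin
      kind s                      ≡⟨ fork-kind A-fork ⟩
      kind B ⊔ kind v₁            ≡⟨ cong (_⊔ kind v₁) (fork-kind B-fork) ⟩
      kind v₃ ⊔ kind v₂ ⊔ kind v₁ ≡⟨ ⊔.xy∙z≈xz∙y (kind v₃) (kind v₂) (kind v₁) ⟩
      kind v₃ ⊔ kind v₁ ⊔ kind v₂ ≡⟨ cong (_⊔ kind v₂) (fork-kind A'-fork) ⟨
      kind A' ⊔ kind v₂           ≡⟨ fork-kind B'-fork ⟨
      kind s'                     ∎

    module _ (absorbing : Absorbing v₁ v₂ v₃) where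

      skeletal-A : isSkeletal A' ≡ isSkeletal s
      skeletal-A = begin
        isSkeletal A'                           ≡⟨ fork-skeletal A'-fork ⟩
        skeletal (kind v₃) (kind v₁)            ≡⟨ proj₁ (absorbing-skeletal absorbing) ⟨
        skeletal (kind v₃ ⊔ kind v₂) (kind v₁)  ≡⟨ cong (λ k → skeletal k (kind v₁)) (fork-kind B-fork) ⟨
        skeletal (kind B) (kind v₁)             ≡⟨ fork-skeletal A-fork ⟨
        isSkeletal s                            ∎

      skeletal-B : isSkeletal s' ≡ isSkeletal B
      skeletal-B = begin
        isSkeletal s'                           ≡⟨ fork-skeletal B'-fork ⟩
        skeletal (kind A') (kind v₂)            ≡⟨ cong (λ k → skeletal k (kind v₂)) (fork-kind A'-fork) ⟩
        skeletal (kind v₃ ⊔ kind v₁) (kind v₂)  ≡⟨ proj₂ (absorbing-skeletal absorbing) ⟩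
        skeletal (kind v₃) (kind v₂)            ≡⟨ fork-skeletal B-fork ⟨
        isSkeletal B                            ∎

      swap1-corresponds : Corresponds s s'
      swap1-corresponds N⊑s with fork-⊑ A-fork N⊑s
      ... | inj₁ refl        = A' , A'⊑s' , name-A' , skeletal-A
      ... | inj₂ (inj₂ N⊑v₁) = _ , ⊑-trans N⊑v₁ v₁⊑s' , refl , refl
      ... | inj₂ (inj₁ N⊑B) with fork-⊑ B-fork N⊑B
      ... | inj₁ refl        = s' , ⊑-refl , name-s' , skeletal-B
      ... | inj₂ (inj₁ N⊑v₃) = _ , ⊑-trans N⊑v₃ v₃⊑s' , refl , refl
      ... | inj₂ (inj₂ N⊑v₂) = _ , ⊑-trans N⊑v₂ v₂⊑s' , refl , refl

  kind-swap : ∀ {T T' v₁ v₂ v₃} → Swap T T' v₁ v₂ v₃ → kind T ≡ kind T'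
  kind-swap (hereL  {r = r} sw) = cong (_⊔ kind r) (kind-swap1 (swap1-forks sw))
  kind-swap (hereR  {l = l} sw) = cong (kind l ⊔_) (kind-swap1 (swap1-forks sw))
  kind-swap (thereL {r = r} sw) = cong (_⊔ kind r) (kind-swap sw)
  kind-swap (thereR {l = l} sw) = cong (kind l ⊔_) (kind-swap sw)

  swap-corresponds : ∀ {T T' v₁ v₂ v₃} → Absorbing v₁ v₂ v₃ → Swap T T' v₁ v₂ v₃ → Corresponds T T'
  swap-corresponds ab (hereL sw)  = corresponds-left (kind-swap1 F) (swap1-corresponds F ab)
    where F = swap1-forks sw
  swap-corresponds ab (hereR sw)  = corresponds-right (kind-swap1 F) (swap1-corresponds F ab)
    where F = swap1-forks sw
  swap-corresponds ab (thereL sw) = corresponds-left (kind-swap sw) (swap-corresponds ab sw)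
  swap-corresponds ab (thereR sw) = corresponds-right (kind-swap sw) (swap-corresponds ab sw)

  absorbed-Pure : ∀ {k} K → Absorbs k (kind K) → Pure K
  absorbed-Pure K k▹K = Sum.map (full⇒Full K) (empty⇒Empty K) (absorbed-pure k▹K)

  module _ {T T' v₁ v₂ v₃ : BT n} (un : UniquelyNamed T) (site : SwapSite T T' v₁ v₂ v₃)
           (to : ∀ {z} → SkelNode S T z → SkelNode S T' z)
           (from : ∀ {z} → SkelNode S T' z → SkelNode S T z) where
    open SwapSite site

    A⊑T : A ⊑ T
    A⊑T = ⊑-trans (child-⊑ A◃P) P⊑T

    module _ {u v : ℕ} {is : List ℕ} (W : Walk T u v is) (uq : Unique (u ∷ is ∷ʳ v))
             (su : SkelNode S T u) (sv : SkelNode S T v) where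

      through-fork : ∀ {Q H O K h} → Q ⊑ T → Child H Q → Fork H h O K →
                     isSkeletal H ≡ false → Pure K →
                     h ∈ u ∷ is ∷ʳ v → name Q ∈ u ∷ is ∷ʳ v × name O ∈ u ∷ is ∷ʳ v
      through-fork {Q} {H} {O} {K} {h} Q⊑T H◃Q fork H-nonskeletal pure h∈ =
        path-through-fork un Q⊑T H◃Q fork W uq
          (skelNode∉pure un K⊑T pure su) (skelNode∉pure un K⊑T pure sv)
          (∈-interior h∈ (λ h≡u → h∉skeleton (subst (SkelNode S T) (sym h≡u) su))
                         (λ h≡v → h∉skeleton (subst (SkelNode S T) (sym h≡v) sv)))
        where
        H⊑T : H ⊑ T
        H⊑T = ⊑-trans (child-⊑ H◃Q) Q⊑T
        K⊑T : K ⊑ T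
        K⊑T = ⊑-trans (child-⊑ (fork-child₂ fork)) H⊑T
        h∉skeleton : ¬ SkelNode S T h
        h∉skeleton = subst (λ z → ¬ SkelNode S T z) (fork-name fork) (¬skelNode un H⊑T H-nonskeletal)

      module _ {h : ℕ} (b-near : a ∈ u ∷ is ∷ʳ v → b ∈ u ∷ is ∷ʳ v ⊎ b ≡ h)
                       (a-near : b ∈ u ∷ is ∷ʳ v → a ∈ u ∷ is ∷ʳ v ⊎ a ≡ h) where

        Near : ℕ → Set
        Near w = w ∈ u ∷ is ∷ʳ v ⊎ w ≡ h

        reroute-pc : ∀ {x y} → x ∈ u ∷ is ∷ʳ v → y ∈ u ∷ is ∷ʳ v → ParentChild T x y →
                     Star (Within Near (TEdge T')) x y
        reroute-pc x∈ y∈ pc with edge-image pc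
        ... | inj₁ e                    = (inj₁ x∈ , e , inj₁ y∈) ◅ ε
        ... | inj₂ (inj₁ (refl , refl)) =
          (inj₁ x∈ , edge-pb , b-near y∈) ◅ (b-near y∈ , edge-ba , inj₁ y∈) ◅ ε
        ... | inj₂ (inj₂ (refl , refl)) =
          (inj₁ x∈ , edge-ba , a-near x∈) ◅ (a-near x∈ , edge-av₃ , inj₁ y∈) ◅ ε

        reroute-edge : ∀ {x y} → x ∈ u ∷ is ∷ʳ v → y ∈ u ∷ is ∷ʳ v → TEdge T x y →
                       Star (Within Near (TEdge T')) x y
        reroute-edge x∈ y∈ (inj₁ pc) = reroute-pc x∈ y∈ pc
        reroute-edge x∈ y∈ (inj₂ pc) =
          Star.reverse (λ (qx , e , qy) → qy , TEdge-sym e , qx) (reroute-pc y∈ x∈ pc)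

    edge-transfer : Absorbing v₁ v₂ v₃ → ∀ {u v} → SkelEdge S T u v → SkelEdge S T' u v
    edge-transfer (inj₁ v₃▹v₂) (su , sv , is , W , uq , off-skeleton) =
      to su , to sv , reroute W uq (All.map (_∘ from) off-skeleton) b∉skeleton′
        (reroute-edge W uq su sv (λ _ → inj₂ refl) a-near)
      where
      B-nonskeletal : isSkeletal B ≡ false
      B-nonskeletal = trans (fork-skeletal B-fork) (absorbs-¬skeletal v₃▹v₂)
      b∉skeleton′ : ¬ SkelNode S T' b
      b∉skeleton′ = subst (λ z → ¬ SkelNode S T' z) (fork-name B-fork)
                      (¬skelNode un (⊑-trans (child-⊑ (fork-child₁ A-fork)) A⊑T) B-nonskeletal ∘ from)
      a-near : b ∈ _ → a ∈ _ ⊎ a ≡ b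
      a-near b∈ = inj₁ (subst (_∈ _) (fork-name A-fork)
        (proj₁ (through-fork W uq su sv A⊑T (fork-child₁ A-fork) B-fork B-nonskeletal
                             (absorbed-Pure v₂ v₃▹v₂) b∈)))
    edge-transfer (inj₂ v₃▹v₁) (su , sv , is , W , uq , off-skeleton) =
      to su , to sv , reroute W uq (All.map (_∘ from) off-skeleton) a∉skeleton′
        (reroute-edge W uq su sv b-near (λ _ → inj₂ refl))
      where
      A-nonskeletal : isSkeletal A ≡ false
      A-nonskeletal = begin
        isSkeletal A                            ≡⟨ fork-skeletal A-fork ⟩
        skeletal (kind B) (kind v₁)             ≡⟨ cong (λ k → skeletal k (kind v₁)) (fork-kind B-fork) ⟩
        skeletal (kind v₃ ⊔ kind v₂) (kind v₁)  ≡⟨ proj₁ (absorbing-skeletal (inj₂ v₃▹v₁)) ⟩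
        skeletal (kind v₃) (kind v₁)            ≡⟨ absorbs-¬skeletal v₃▹v₁ ⟩
        false                                   ∎
        where open ≡-Reasoning
      a∉skeleton′ : ¬ SkelNode S T' a
      a∉skeleton′ = subst (λ z → ¬ SkelNode S T' z) (fork-name A-fork)
                      (¬skelNode un A⊑T A-nonskeletal ∘ from)
      b-near : a ∈ _ → b ∈ _ ⊎ b ≡ a
      b-near a∈ = inj₁ (subst (_∈ _) (fork-name B-fork)
        (proj₂ (through-fork W uq su sv P⊑T A◃P A-fork A-nonskeletal (absorbed-Pure v₁ v₃▹v₁) a∈)))

  swap-same-skeleton : ∀ {T T' v₁ v₂ v₃} → UniquelyNamed T → Swap T T' v₁ v₂ v₃ → Absorbing v₁ v₂ v₃ →
                       SameSkeleton S T T'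
  swap-same-skeleton {T} {T'} un sw absorbing =
    (λ _ → to , from) ,
    (λ _ _ → edge-transfer un (swap-site sw) to from absorbing ,
             edge-transfer (uniquelyNamed-swap sw un) (swap-site (swap-reverse sw)) from to
                           (Sum.swap absorbing))
    where
    to : ∀ {z} → SkelNode S T z → SkelNode S T' z
    to = corresponds-skelNode (swap-corresponds absorbing sw)
    from : ∀ {z} → SkelNode S T' z → SkelNode S T z
    from = corresponds-skelNode (swap-corresponds (Sum.swap absorbing) (swap-reverse sw))

lemma9p15 : ∀ (d n : ℕ) (𝒱 : Arrangement d n) (Tb T Tswap x y : BT n) →
    IsRRD Tb → IsRRD T → x ⊑ Tb → y ⊑ Tb →
    XSwap (Fam x) T Tswap →
    SameSkeleton (Fam y) T Tswap
lemma9p15 _ n _ Tb T Tswap x y (_ , _ , Tb-leaves) (_ , T-named , _) x⊑Tb y⊑Tb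
          (v₁ , v₂ , v₃ , sw , v₃-mixed , sides) =
  swap-same-skeleton T-named sw
    (absorbing-side {v₁ = v₁} {v₂} {v₃} (fam-laminar Tb-leaves-unique x⊑Tb y⊑Tb) v₃-mixed sides)
  where
  open Kinds (Fam y) (λ e → DecMembership._∈?_ Fin._≟_ e (leaves y))
  Tb-leaves-unique : Unique (leaves Tb)
  Tb-leaves-unique = unique-↭ (↭-sym Tb-leaves) (allFin⁺ n)
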